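{- Let $E$ be a finite set, let $(E,\mathcal{F})$ be a $k$-truncated antimatroid of rank $k$, and let $F:\mathcal{F}_{k-1}\to\mathbb{R}$ be a set function, where $\mathcal{F}_{k-1}=\{X\in\mathcal{F}:|X|\le k-1\}$. Then $F$ is quasi-concave if and only if there exists a monotone linkage function $\pi:E\times 2^{E}\to\mathbb{R}$ such that for every $X\in\mathcal{F}_{k-1}$, \[ F(X)=\min_{x\in\Gamma(X)}\pi(x,X). \]
   Context: A set system over a finite set $E$ is a pair $(E,\mathcal{F})$ with $\mathcal{F}\subseteq 2^{E}$; members of $\mathcal{F}$ are called feasible. A non-empty set system $(E,\mathcal{A})$ is an antimatroid if (A1) every non-empty $X\in\mathcal{A}$ contains some $x$ with $X-\{x\}\in\mathcal{A}$, and (A2) for all $X,Y\in\mathcal{A}$ with $X\not\subseteq Y$ there is $x\in X-Y$ with $Y\cup\{x\}\in\mathcal{A}$. The rank of a set system $(E,\mathcal{F})$ is $\max\{|Y|:Y\in\mathcal{F}\}$. A $k$-truncated antimatroid is a set system $(E,\mathcal{F})$ with $\mathcal{F}=\{X\in\mathcal{A}:|X|\le k\}$ for some antimatroid $(E,\mathcal{A})$; here it is assumed to have rank $k$ (i.e. $k$ is at most the rank of $\mathcal{A}$). For $X\in\mathcal{F}$, $\Gamma(X)=\{x\in E-X: X\cup\{x\}\in\mathcal{F}\}$ is the set of feasible continuations of $X$. A function $\pi:E\times 2^{E}\to\mathbb{R}$ is a monotone linkage function if for all $X\subseteq Y\subseteq E$ and $x\in E$, $\pi(x,X)\ge\pi(x,Y)$.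 A set function $F$ defined on $\mathcal{F}_{k-1}$ is quasi-concave if for all $X,Y\in\mathcal{F}_{k-1}$ and every maximal feasible subset $Z$ of $X\cap Y$ (i.e. maximal member of $\mathcal{F}$ contained in $X\cap Y$), $F(Z)\ge\min\{F(X),F(Y)\}$. -}

module Defs where

open import Level using (Level; _⊔_)
open import Data.Nat using (ℕ; _≤_; _∸_)
open import Data.Bool using (Bool; T)
open import Data.Fin using (Fin)
open import Data.Fin.Subset using (Subset; ⊥; _∈_; _∉_; _⊆_; _⊈_; _∩_; _∪_; _-_; ⁅_⁆; ∣_∣)
open import Data.Product using (Σ; ∃; _×_; _,_)
open import Relation.Binary.PropositionalEquality using (_≡_; _≢_)
open import Relation.Binary.Bundles using (TotalOrder)
import Algebra.Construct.NaturalChoice.Min as Min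

-- A set system over E = Fin n is given by its (decidable) membership test.
SetSystem : ℕ → Set
SetSystem n = Subset n → Bool

Feasible : ∀ {n} → SetSystem n → Subset n → Set
Feasible 𝒜 X = T (𝒜 X)

record IsAntimatroid {n : ℕ} (𝒜 : SetSystem n) : Set where
  field
    nonempty : ∃ λ X → Feasible 𝒜 X
    A1 : ∀ X → Feasible 𝒜 X → X ≢ ⊥ →
         ∃ λ x → x ∈ X × Feasible 𝒜 (X - x)
    A2 : ∀ X Y → Feasible 𝒜 X → Feasible 𝒜 Y → X ⊈ Y →
         ∃ λ x → x ∈ X × x ∉ Y × Feasible 𝒜 (Y ∪ ⁅ x ⁆)

Truncate : ∀ {n} → SetSystem n → ℕ → Subset n → Set
Truncate 𝒜 k X = Feasible 𝒜 X × ∣ X ∣ ≤ k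

-- rank(𝒜) ≥ k, i.e. the k-truncation has rank exactly k.
RankAtLeast : ∀ {n} → SetSystem n → ℕ → Set
RankAtLeast 𝒜 k = ∃ λ X → Feasible 𝒜 X × ∣ X ∣ ≡ k

InΓ : ∀ {n} → SetSystem n → ℕ → Subset n → Fin n → Set
InΓ 𝒜 k X x = x ∉ X × Truncate 𝒜 k (X ∪ ⁅ x ⁆)

module _ {a ℓ₁ ℓ₂ : Level} (O : TotalOrder a ℓ₁ ℓ₂) where
  open TotalOrder O renaming (Carrier to R; _≤_ to _≼_)
  open Min O using (_⊓_)

  MaximalFeasibleSubset : ∀ {n} → (Subset n → Set) → Subset n → Subset n → Set
  MaximalFeasibleSubset 𝓕 S Z =
    𝓕 Z × Z ⊆ S × (∀ W → 𝓕 W → Z ⊆ W → W ⊆ S → W ≡ Z)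

  -- F is quasi-concave on 𝓕_{k-1} (values of F outside 𝓕_{k-1} are irrelevant).
  QuasiConcave : ∀ {n} → SetSystem n → ℕ → (Subset n → R) → Set ℓ₂
  QuasiConcave 𝒜 k F =
    ∀ X Y → Truncate 𝒜 (k ∸ 1) X → Truncate 𝒜 (k ∸ 1) Y →
    ∀ Z → MaximalFeasibleSubset (Truncate 𝒜 k) (X ∩ Y) Z →
    (F X ⊓ F Y) ≼ F Z

  MonotoneLinkage : ∀ {n} → (Fin n → Subset n → R) → Set ℓ₂
  MonotoneLinkage π = ∀ x X Y → X ⊆ Y → π x Y ≼ π x X

  IsMinOver : ∀ {n} → (Fin n → Set) → (Fin n → R) → R → Set (ℓ₁ ⊔ ℓ₂)
  IsMinOver P f v = (∃ λ x → P x × v ≈ f x) × (∀ x → P x → v ≼ f x)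

{-# OPTIONS --safe #-}
module Submission where

-- If F(X) = min_{x ∈ Γ(X)} π(x, X) with π monotone, let Z be a maximal feasible subset of
-- X ∩ Y and let z ∈ Γ(Z) attain F(Z). By maximality z ∉ X ∩ Y, say z ∉ X; augmentation
-- then puts z in Γ(X), so F(X) ≤ π(z, X) ≤ π(z, Z) = F(Z).
--
-- Conversely, for quasi-concave F let π(x, X) be the largest F(Z) over the Z ∈ 𝓕_{k-1} with
-- X ⊆ Z and x ∈ Γ(Z), or the minimum of F if there is no such Z; then π is monotone and
-- F(X) ≤ π(x, X) on Γ(X). For the reverse bound keep a set K ⊇ X in 𝓕_{k-1} with
-- F(K) ≥ π(x, X) for some x ∈ Γ(X), and for each y ∈ Γ(X) in turn replace K by a maximal
-- feasible subset of K ∩ Z_y containing X, where Z_y ∌ y attains π(y, X). Quasi-concavity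
-- preserves the invariant; at the end K meets Γ(X) nowhere, so augmentation forces K = X.

open import Defs
open import Level using (Level; _⊔_)
open import Data.Nat using (ℕ; _<_; _∸_)
open import Data.Fin using (Fin)
open import Data.Fin.Subset using (Subset)
open import Data.Product using (Σ; ∃; _×_)
open import Function.Bundles using (_⇔_)
open import Relation.Binary.Bundles using (TotalOrder)

open import Data.Nat using (_≤_; _+_; _≤?_; z≤n; s≤s; >-nonZero)
open import Data.Nat.Properties
  using (≤-trans; ≤-reflexive; n≤1+n; +-suc; +-comm; +-monoʳ-≤; m∸n≤m; <-≤-trans; <-irrefl;
        m≤pred[n]⇒suc[m]≤n; module ≤-Reasoning)
open import Data.Nat.Induction using (<-wellFounded)
open import Induction.WellFounded using (Acc; acc)
open import Data.Vec using ([]; _∷_)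
open import Data.Fin.Subset using (_∈_; _∉_; _⊆_; _⊈_; _∩_; _∪_; ⁅_⁆; ∣_∣; ∁; ⊥; inside; outside)
open import Data.Fin.Subset.Properties
  using (_∈?_; _⊆?_; _⊂?_; anySubset?; ⊆-refl; ⊆-trans; ⊆-antisym; p⊆q⇒∣p∣≤∣q∣; p⊂q⇒p⊆q;
        p⊂q⇒∣p∣<∣q∣; p⊂q⇒∁p⊃∁q; p⊆p∪q; q⊆p∪q; x∈p∪q⁻; p∩q⊆p; p∩q⊆q; x∈p∩q⁺; x∈⁅x⁆;
        x∈⁅y⁆⇒x≡y; ∣⁅x⁆∣≡1)
open import Data.Product using (_,_; proj₂)
open import Data.Sum using (_⊎_; inj₁; inj₂; [_,_]′)
open import Data.Empty using (⊥-elim)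
open import Data.List using (List; []; _∷_; [_]; map; _++_; allFin)
open import Data.List.Membership.Propositional using () renaming (_∈_ to _∈ˡ_)
open import Data.List.Membership.Propositional.Properties using (∈-map⁺; ∈-++⁺ˡ; ∈-++⁺ʳ; ∈-allFin)
open import Data.List.Relation.Unary.Any using (here)
open import Data.List.Relation.Unary.All as All using (All; []; _∷_)
open import Relation.Nullary using (¬_; Dec; yes; no; contradiction)
open import Relation.Nullary.Decidable using (_×-dec_; ¬?; T?)
open import Relation.Unary using (Decidable)
open import Relation.Binary.PropositionalEquality using (_≡_; refl; sym; cong; subst)
open import Function.Base using (id; _∘_)
open import Function.Bundles using (mk⇔)
import Algebra.Construct.NaturalChoice.Min as Min
import Data.List.Extrema as Extrema

p∪⁅x⁆⊆q : ∀ {n} {p q : Subset n} {x} → p ⊆ q → x ∈ q → p ∪ ⁅ x ⁆ ⊆ q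
p∪⁅x⁆⊆q {p = p} {q} {x} p⊆q x∈q y∈p∪⁅x⁆ with x∈p∪q⁻ p ⁅ x ⁆ y∈p∪⁅x⁆
... | inj₁ y∈p = p⊆q y∈p
... | inj₂ y∈⁅x⁆ = subst (_∈ q) (sym (x∈⁅y⁆⇒x≡y x y∈⁅x⁆)) x∈q

x∈p∪⁅x⁆ : ∀ {n} (p : Subset n) (x : Fin n) → x ∈ p ∪ ⁅ x ⁆
x∈p∪⁅x⁆ p x = q⊆p∪q p ⁅ x ⁆ (x∈⁅x⁆ x)

∣p∪q∣≤∣p∣+∣q∣ : ∀ {n} (p q : Subset n) → ∣ p ∪ q ∣ ≤ ∣ p ∣ + ∣ q ∣
∣p∪q∣≤∣p∣+∣q∣ []            []            = z≤n
∣p∪q∣≤∣p∣+∣q∣ (outside ∷ p) (outside ∷ q) = ∣p∪q∣≤∣p∣+∣q∣ p q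
∣p∪q∣≤∣p∣+∣q∣ (outside ∷ p) (inside  ∷ q) =
  ≤-trans (s≤s (∣p∪q∣≤∣p∣+∣q∣ p q)) (≤-reflexive (sym (+-suc ∣ p ∣ ∣ q ∣)))
∣p∪q∣≤∣p∣+∣q∣ (inside  ∷ p) (outside ∷ q) = s≤s (∣p∪q∣≤∣p∣+∣q∣ p q)
∣p∪q∣≤∣p∣+∣q∣ (inside  ∷ p) (inside  ∷ q) =
  s≤s (≤-trans (∣p∪q∣≤∣p∣+∣q∣ p q) (+-monoʳ-≤ ∣ p ∣ (n≤1+n ∣ q ∣)))

allSubsets : ∀ n → List (Subset n)
allSubsets ℕ.zero    = [ [] ]
allSubsets (ℕ.suc n) = map (inside ∷_) (allSubsets n) ++ map (outside ∷_) (allSubsets n)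

∈-allSubsets : ∀ {n} (p : Subset n) → p ∈ˡ allSubsets n
∈-allSubsets []            = here refl
∈-allSubsets (inside ∷ p)  = ∈-++⁺ˡ (∈-map⁺ (inside ∷_) (∈-allSubsets p))
∈-allSubsets (outside ∷ p) = ∈-++⁺ʳ _ (∈-map⁺ (outside ∷_) (∈-allSubsets p))

Augmentation : ∀ {n} → SetSystem n → Set
Augmentation 𝒜 = ∀ X Y → Feasible 𝒜 X → Feasible 𝒜 Y → X ⊈ Y →
                 ∃ λ x → x ∈ X × x ∉ Y × Feasible 𝒜 (Y ∪ ⁅ x ⁆)

module AugmentationProperties {n} {𝒜 : SetSystem n} (augment : Augmentation 𝒜) where

  interval-property : ∀ {Z X z} → Z ⊆ X → z ∉ X → Feasible 𝒜 X →
                      Feasible 𝒜 (Z ∪ ⁅ z ⁆) → Feasible 𝒜 (X ∪ ⁅ z ⁆)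
  interval-property {Z} {X} {z} Z⊆X z∉X fX fZz
    with augment (Z ∪ ⁅ z ⁆) X fZz fX (λ Zz⊆X → z∉X (Zz⊆X (x∈p∪⁅x⁆ Z z)))
  ... | w , w∈Zz , w∉X , fXw with x∈p∪q⁻ Z ⁅ z ⁆ w∈Zz
  ...   | inj₁ w∈Z = contradiction (Z⊆X w∈Z) w∉X
  ...   | inj₂ w∈z = subst (λ v → Feasible 𝒜 (X ∪ ⁅ v ⁆)) (x∈⁅y⁆⇒x≡y z w∈z) fXw

  augment-from-larger : ∀ {X Y} → Feasible 𝒜 X → Feasible 𝒜 Y → ∣ X ∣ < ∣ Y ∣ →
                        ∃ λ y → y ∉ X × Feasible 𝒜 (X ∪ ⁅ y ⁆)
  augment-from-larger fX fY ∣X∣<∣Y∣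
    with augment _ _ fY fX (λ Y⊆X → <-irrefl refl (<-≤-trans ∣X∣<∣Y∣ (p⊆q⇒∣p∣≤∣q∣ Y⊆X)))
  ... | y , _ , y∉X , fXy = y , y∉X , fXy

  ⊆-if-unaugmentable : ∀ {Y X} → Feasible 𝒜 Y → Feasible 𝒜 X →
                       (∀ {y} → y ∈ Y → y ∉ X → ¬ Feasible 𝒜 (X ∪ ⁅ y ⁆)) → Y ⊆ X
  ⊆-if-unaugmentable {Y} {X} fY fX unaug with Y ⊆? X
  ... | yes Y⊆X = Y⊆X
  ... | no  Y⊈X with augment Y X fY fX Y⊈X
  ...   | y , y∈Y , y∉X , fXy = contradiction fXy (unaug y∈Y y∉X)

module TruncationProperties {n} (𝒜 : SetSystem n) where

  truncate? : ∀ j → Decidable (Truncate 𝒜 j)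
  truncate? j Z = T? (𝒜 Z) ×-dec (∣ Z ∣ ≤? j)

  truncate-≤ : ∀ {i j X} → i ≤ j → Truncate 𝒜 i X → Truncate 𝒜 j X
  truncate-≤ i≤j (fX , ∣X∣≤i) = fX , ≤-trans ∣X∣≤i i≤j

  truncate-⊆ : ∀ {j X Y} → Feasible 𝒜 X → X ⊆ Y → Truncate 𝒜 j Y → Truncate 𝒜 j X
  truncate-⊆ fX X⊆Y (_ , ∣Y∣≤j) = fX , ≤-trans (p⊆q⇒∣p∣≤∣q∣ X⊆Y) ∣Y∣≤j

module Continuations {n} {𝒜 : SetSystem n} (augment : Augmentation 𝒜) {k} (0<k : 0 < k) where
  open AugmentationProperties augment
  open TruncationProperties 𝒜

  InΓ? : ∀ X → Decidable (InΓ 𝒜 k X)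
  InΓ? X y = ¬? (y ∈? X) ×-dec truncate? k (X ∪ ⁅ y ⁆)

  ≤k∸1⇒<k : ∀ {m} → m ≤ k ∸ 1 → m < k
  ≤k∸1⇒<k = m≤pred[n]⇒suc[m]≤n {{>-nonZero 0<k}}

  ∣X∪⁅y⁆∣≤k : ∀ (X : Subset n) y → ∣ X ∣ ≤ k ∸ 1 → ∣ X ∪ ⁅ y ⁆ ∣ ≤ k
  ∣X∪⁅y⁆∣≤k X y ∣X∣≤k-1 = begin
    ∣ X ∪ ⁅ y ⁆ ∣     ≤⟨ ∣p∪q∣≤∣p∣+∣q∣ X ⁅ y ⁆ ⟩
    ∣ X ∣ + ∣ ⁅ y ⁆ ∣ ≡⟨ cong (∣ X ∣ +_) (∣⁅x⁆∣≡1 y) ⟩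
    ∣ X ∣ + 1         ≡⟨ +-comm ∣ X ∣ 1 ⟩
    1 + ∣ X ∣         ≤⟨ ≤k∸1⇒<k ∣X∣≤k-1 ⟩
    k                 ∎
    where open ≤-Reasoning

  Γ-nonempty : RankAtLeast 𝒜 k → ∀ {X} → Truncate 𝒜 (k ∸ 1) X → ∃ (InΓ 𝒜 k X)
  Γ-nonempty (Y , fY , ∣Y∣≡k) {X} (fX , ∣X∣≤k-1)
    with augment-from-larger fX fY (subst (_ <_) (sym ∣Y∣≡k) (≤k∸1⇒<k ∣X∣≤k-1))
  ... | y , y∉X , fXy = y , y∉X , fXy , ∣X∪⁅y⁆∣≤k X y ∣X∣≤k-1

  Γ-lift : ∀ {Z V z} → Z ⊆ V → Truncate 𝒜 (k ∸ 1) V → InΓ 𝒜 k Z z → z ∉ V → InΓ 𝒜 k V z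
  Γ-lift {V = V} {z} Z⊆V (fV , ∣V∣≤k-1) (_ , fZz , _) z∉V =
    z∉V , interval-property Z⊆V z∉V fV fZz , ∣X∪⁅y⁆∣≤k V z ∣V∣≤k-1

module _ {a ℓ₁ ℓ₂} (O : TotalOrder a ℓ₁ ℓ₂) where
  open TotalOrder O renaming (Carrier to R; _≤_ to _≼_; refl to ≼-refl)
  open Min O using (_⊓_; ⊓-sel; x⊓y≤x; x⊓y≤y)
  open Extrema O using (argmax; argmin; f[xs]≤f[argmax]; f[argmax]≤v⁺; f[argmin]≤f[xs])
  open import Relation.Binary.Reasoning.PartialOrder poset

  module _ {n} (f : Subset n → R) where
    argmaxSubset : Subset n
    argmaxSubset = argmax f ⊥ (allSubsets n)

    argminSubset : Subset n
    argminSubset = argmin f ⊥ (allSubsets n)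

    ≼-argmaxSubset : ∀ Z → f Z ≼ f argmaxSubset
    ≼-argmaxSubset Z = All.lookup (f[xs]≤f[argmax] ⊥ (allSubsets n)) (∈-allSubsets Z)

    argmaxSubset-least : ∀ {v} → (∀ Z → f Z ≼ v) → f argmaxSubset ≼ v
    argmaxSubset-least f≼v =
      f[argmax]≤v⁺ {xs = allSubsets n} (f≼v ⊥) (All.tabulate (λ {Z} _ → f≼v Z))

    argminSubset-≼ : ∀ Z → f argminSubset ≼ f Z
    argminSubset-≼ Z = All.lookup (f[argmin]≤f[xs] ⊥ (allSubsets n)) (∈-allSubsets Z)

  ⊓-≼-split : ∀ {u v w} → u ⊓ v ≼ w → u ≼ w ⊎ v ≼ w
  ⊓-≼-split {u} {v} u⊓v≼w with ⊓-sel u v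
  ... | inj₁ u⊓v≈u = inj₁ (≤-respˡ-≈ u⊓v≈u u⊓v≼w)
  ... | inj₂ u⊓v≈v = inj₂ (≤-respˡ-≈ u⊓v≈v u⊓v≼w)

  extend-to-maximal : ∀ {n} {𝓕 : Subset n → Set} → Decidable 𝓕 → ∀ {S Z} → 𝓕 Z → Z ⊆ S →
                      ∃ λ K → MaximalFeasibleSubset O 𝓕 S K × Z ⊆ K
  extend-to-maximal {𝓕 = 𝓕} 𝓕? {S} 𝓕Z Z⊆S = go 𝓕Z Z⊆S (<-wellFounded _)
    where
    go : ∀ {Z} → 𝓕 Z → Z ⊆ S → Acc _<_ ∣ ∁ Z ∣ → ∃ λ K → MaximalFeasibleSubset O 𝓕 S K × Z ⊆ K
    go {Z} 𝓕Z Z⊆S (acc smaller) with anySubset? (λ W → 𝓕? W ×-dec (Z ⊂? W ×-dec W ⊆? S))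
    ... | yes (W , 𝓕W , Z⊂W , W⊆S) with go 𝓕W W⊆S (smaller (p⊂q⇒∣p∣<∣q∣ (p⊂q⇒∁p⊃∁q Z⊂W)))
    ...   | K , maxK , W⊆K = K , maxK , ⊆-trans (p⊂q⇒p⊆q Z⊂W) W⊆K
    go {Z} 𝓕Z Z⊆S _ | no ∄W = Z , (𝓕Z , Z⊆S , maximal) , id
      where
      maximal : ∀ W → 𝓕 W → Z ⊆ W → W ⊆ S → W ≡ Z
      maximal W 𝓕W Z⊆W W⊆S = ⊆-antisym W⊆Z Z⊆W
        where
        W⊆Z : W ⊆ Z
        W⊆Z {x} x∈W with x ∈? Z
        ... | yes x∈Z = x∈Z
        ... | no  x∉Z = ⊥-elim (∄W (W , 𝓕W , (Z⊆W , x , x∈W , x∉Z) , W⊆S))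

  continuation-escapes : ∀ {n} {𝓕 : Subset n → Set} {S Z z} → MaximalFeasibleSubset O 𝓕 S Z →
                         𝓕 (Z ∪ ⁅ z ⁆) → z ∉ Z → z ∉ S
  continuation-escapes {Z = Z} {z} (_ , Z⊆S , maximal) 𝓕Zz z∉Z z∈S =
    z∉Z (subst (z ∈_) (maximal _ 𝓕Zz (p⊆p∪q ⁅ z ⁆) (p∪⁅x⁆⊆q Z⊆S z∈S)) (x∈p∪⁅x⁆ Z z))

  module _ {n} {𝒜 : SetSystem n} (augment : Augmentation 𝒜) {k} (0<k : 0 < k) where
    open AugmentationProperties augment
    open TruncationProperties 𝒜
    open Continuations augment 0<k

    Induces : (Fin n → Subset n → R) → (Subset n → R) → Set (ℓ₁ ⊔ ℓ₂)
    Induces π F = ∀ X → Truncate 𝒜 (k ∸ 1) X → IsMinOver O (InΓ 𝒜 k X) (λ x → π x X) (F X)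

    module _ {F : Subset n → R} (π : Fin n → Subset n → R)
             (π-monotone : MonotoneLinkage O π) (π-induces-F : Induces π F) where

      induced-≼-escaping : ∀ {Z V z} → Truncate 𝒜 (k ∸ 1) V → Z ⊆ V → InΓ 𝒜 k Z z → z ∉ V →
                           F V ≼ π z Z
      induced-≼-escaping {Z} {V} {z} tV Z⊆V Γz z∉V = begin
        F V   ≤⟨ proj₂ (π-induces-F V tV) z (Γ-lift Z⊆V tV Γz z∉V) ⟩
        π z V ≤⟨ π-monotone z Z V Z⊆V ⟩
        π z Z ∎

      linkage⇒quasiConcave : QuasiConcave O 𝒜 k F
      linkage⇒quasiConcave X Y tX tY Z maxZ@((fZ , _) , Z⊆X∩Y , _)
        with π-induces-F Z (truncate-⊆ fZ (⊆-trans Z⊆X∩Y (p∩q⊆p X Y)) tX)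
      ... | (z , Γz@(z∉Z , tZz) , FZ≈πzZ) , _ = begin
        F X ⊓ F Y ≤⟨ min≼πzZ ⟩
        π z Z     ≈⟨ Eq.sym FZ≈πzZ ⟩
        F Z       ∎
        where
        z∉X∩Y : z ∉ X ∩ Y
        z∉X∩Y = continuation-escapes maxZ tZz z∉Z
        min≼πzZ : F X ⊓ F Y ≼ π z Z
        min≼πzZ with z ∈? X
        ... | no  z∉X = trans (x⊓y≤x _ _)
                (induced-≼-escaping tX (⊆-trans Z⊆X∩Y (p∩q⊆p X Y)) Γz z∉X)
        ... | yes z∈X = trans (x⊓y≤y _ _)
                (induced-≼-escaping tY (⊆-trans Z⊆X∩Y (p∩q⊆q X Y)) Γz (z∉X∩Y ∘ x∈p∩q⁺ ∘ (z∈X ,_)))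

    module LinkageOf (F : Subset n → R) where

      Candidate : Fin n → Subset n → Subset n → Set
      Candidate x X Z = Truncate 𝒜 (k ∸ 1) Z × X ⊆ Z × InΓ 𝒜 k Z x

      candidate? : ∀ x X → Decidable (Candidate x X)
      candidate? x X Z = truncate? (k ∸ 1) Z ×-dec X ⊆? Z ×-dec InΓ? Z x

      lowest : R
      lowest = F (argminSubset F)

      value : Fin n → Subset n → Subset n → R
      value x X Z with candidate? x X Z
      ... | yes _ = F Z
      ... | no  _ = lowest

      π : Fin n → Subset n → R
      π x X = value x X (argmaxSubset (value x X))

      value-candidate : ∀ {x X Z} → Candidate x X Z → value x X Z ≡ F Z
      value-candidate {x} {X} {Z} cZ with candidate? x X Z
      ... | yes _ = refl
      ... | no ¬c = contradiction cZ ¬c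

      value-antitone : ∀ {x X Y} → X ⊆ Y → ∀ Z → value x Y Z ≼ value x X Z
      value-antitone {x} {X} {Y} X⊆Y Z with candidate? x Y Z | candidate? x X Z
      ... | yes _                 | yes _ = ≼-refl
      ... | yes (tZ , Y⊆Z , Γx)   | no ¬c = ⊥-elim (¬c (tZ , ⊆-trans X⊆Y Y⊆Z , Γx))
      ... | no  _                 | yes _ = argminSubset-≼ F Z
      ... | no  _                 | no  _ = ≼-refl

      value-dominated : ∀ {x X} → Candidate x X X → ∀ Z →
                        ∃ λ W → Candidate x X W × value x X Z ≼ F W
      value-dominated {x} {X} cX Z with candidate? x X Z
      ... | yes cZ = Z , cZ , ≼-refl
      ... | no  _  = X , cX , argminSubset-≼ F X

      π-monotone : MonotoneLinkage O π
      π-monotone x X Y X⊆Y = argmaxSubset-least (value x Y) λ Z →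
        trans (value-antitone X⊆Y Z) (≼-argmaxSubset (value x X) Z)

      F≼π : ∀ {x X} → Truncate 𝒜 (k ∸ 1) X → InΓ 𝒜 k X x → F X ≼ π x X
      F≼π {x} {X} tX Γx =
        subst (_≼ π x X) (value-candidate (tX , ⊆-refl , Γx)) (≼-argmaxSubset (value x X) X)

      π-attained : ∀ {x X} → Truncate 𝒜 (k ∸ 1) X → InΓ 𝒜 k X x →
                   ∃ λ Z → Candidate x X Z × π x X ≼ F Z
      π-attained {x} {X} tX Γx = value-dominated (tX , ⊆-refl , Γx) (argmaxSubset (value x X))

      Dominated : Subset n → Subset n → Set ℓ₂
      Dominated X K = ∃ λ x → InΓ 𝒜 k X x × π x X ≼ F K

      Avoids : Subset n → List (Fin n) → Subset n → Set
      Avoids X L K = All (λ y → InΓ 𝒜 k X y → y ∉ K) L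

      avoids-⊆ : ∀ {X L K K′} → K′ ⊆ K → Avoids X L K → Avoids X L K′
      avoids-⊆ K′⊆K = All.map (λ avoidsK Γy → avoidsK Γy ∘ K′⊆K)

      Avoiding : Subset n → List (Fin n) → Subset n → Set ℓ₂
      Avoiding X L K = Truncate 𝒜 (k ∸ 1) K × X ⊆ K × Dominated X K × Avoids X L K

      dominated-meet : ∀ {X K Z K′} → Dominated X K → Dominated X Z → F K ⊓ F Z ≼ F K′ →
                       Dominated X K′
      dominated-meet (x , Γx , πx≼FK) (y , Γy , πy≼FZ) FK⊓FZ≼FK′ =
        [ (λ FK≼FK′ → x , Γx , trans πx≼FK FK≼FK′) , (λ FZ≼FK′ → y , Γy , trans πy≼FZ FZ≼FK′) ]′
          (⊓-≼-split FK⊓FZ≼FK′)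

      module _ (qc : QuasiConcave O 𝒜 k F) where

        shrink-avoiding : ∀ {X K y} → Truncate 𝒜 (k ∸ 1) X → Truncate 𝒜 (k ∸ 1) K → X ⊆ K →
                          Dominated X K → InΓ 𝒜 k X y →
                          ∃ λ K′ → Truncate 𝒜 (k ∸ 1) K′ × X ⊆ K′ × K′ ⊆ K × y ∉ K′ × Dominated X K′
        shrink-avoiding {X} {K} {y} tX tK X⊆K domK Γy =
          let Z , (tZ , X⊆Z , y∉Z , _) , πy≼FZ = π-attained tX Γy
              K′ , maxK′@((fK′ , _) , K′⊆K∩Z , _) , X⊆K′ =
                extend-to-maximal (truncate? k) (truncate-≤ (m∸n≤m k 1) tX)
                                  (λ x∈X → x∈p∩q⁺ (X⊆K x∈X , X⊆Z x∈X))
              K′⊆K = ⊆-trans K′⊆K∩Z (p∩q⊆p K Z)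
          in K′ , truncate-⊆ fK′ K′⊆K tK , X⊆K′ , K′⊆K , y∉Z ∘ ⊆-trans K′⊆K∩Z (p∩q⊆q K Z) ,
             dominated-meet domK (y , Γy , πy≼FZ) (qc K Z tK tZ K′ maxK′)

        avoid-next : ∀ {X y L} → Truncate 𝒜 (k ∸ 1) X → Dec (InΓ 𝒜 k X y) →
                     ∃ (Avoiding X L) → ∃ (Avoiding X (y ∷ L))
        avoid-next tX (no ¬Γy) (K , tK , X⊆K , domK , avoidsL) =
          K , tK , X⊆K , domK , (λ Γy → contradiction Γy ¬Γy) ∷ avoidsL
        avoid-next tX (yes Γy) (K , tK , X⊆K , domK , avoidsL) =
          let K′ , tK′ , X⊆K′ , K′⊆K , y∉K′ , domK′ = shrink-avoiding tX tK X⊆K domK Γy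
          in K′ , tK′ , X⊆K′ , domK′ , (λ _ → y∉K′) ∷ avoids-⊆ K′⊆K avoidsL

        avoid-all : RankAtLeast 𝒜 k → ∀ {X} → Truncate 𝒜 (k ∸ 1) X → ∀ L → ∃ (Avoiding X L)
        avoid-all rank tX [] =
          let x , Γx = Γ-nonempty rank tX
              Z , (tZ , X⊆Z , _) , πx≼FZ = π-attained tX Γx
          in Z , tZ , X⊆Z , (x , Γx , πx≼FZ) , []
        avoid-all rank {X} tX (y ∷ L) = avoid-next tX (InΓ? X y) (avoid-all rank tX L)

        π-induces-F : RankAtLeast 𝒜 k → Induces π F
        π-induces-F rank X tX@(fX , ∣X∣≤k-1) =
          let K , (fK , _) , X⊆K , (x , Γx , πx≼FK) , avoids = avoid-all rank tX (allFin n)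
              K⊆X = ⊆-if-unaugmentable fK fX λ {y} y∈K y∉X fXy →
                All.lookup avoids (∈-allFin y) (y∉X , fXy , ∣X∪⁅y⁆∣≤k X y ∣X∣≤k-1) y∈K
              πx≼FX = subst (λ V → π x X ≼ F V) (⊆-antisym K⊆X X⊆K) πx≼FK
          in (x , Γx , antisym (F≼π tX Γx) πx≼FX) , λ _ → F≼π tX

    quasiConcave⇒linkage : RankAtLeast 𝒜 k → ∀ {F} → QuasiConcave O 𝒜 k F →
                           Σ (Fin n → Subset n → R) λ π → MonotoneLinkage O π × Induces π F
    quasiConcave⇒linkage rank {F} qc = π , π-monotone , π-induces-F qc rank
      where open LinkageOf F

theorem2 : ∀ {a ℓ₁ ℓ₂ : Level} (O : TotalOrder a ℓ₁ ℓ₂) (n : ℕ) (𝒜 : SetSystem n) (k : ℕ) →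
    IsAntimatroid 𝒜 → RankAtLeast 𝒜 k → 0 < k →
    (F : Subset n → TotalOrder.Carrier O) →
    QuasiConcave O 𝒜 k F ⇔
      (Σ (Fin n → Subset n → TotalOrder.Carrier O) λ π →
        MonotoneLinkage O π ×
        (∀ X → Truncate 𝒜 (k ∸ 1) X → IsMinOver O (InΓ 𝒜 k X) (λ x → π x X) (F X)))
theorem2 O n 𝒜 k antimatroid rank 0<k F =
  mk⇔ (quasiConcave⇒linkage O augment 0<k rank)
      (λ (π , π-monotone , π-induces-F) → linkage⇒quasiConcave O augment 0<k π π-monotone π-induces-F)
  where
  augment : Augmentation 𝒜
  augment = IsAntimatroid.A2 antimatroid
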